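{- Let $n\ge1$ and let $\mathcal D_n=\{e_0,\ldots,e_n\}\subseteq(C_3)^n$ be the canonical set. Then the structure $\mathfrak M=\mathbf D((C_3)^n,\mathcal D_n)$ is Desarguesian.
   Context: $C_3=\mathbb Z/3\mathbb Z$, $(C_3)^n$ written additively; $e_0=0$, $e_i$ the $i$-th standard unit vector. $\mathbf D(\mathsf G,D)$ is the incidence structure whose points are elements of $G$ and whose lines are the translates $b+D$, incidence being membership. Desarguesian: whenever $L_1,L_2,L_3$ are distinct lines through a point $o$, $p'_i,p''_i\neq o$ are points on $L_i$ such that $(p'_1,p'_2,p'_3)$ and $(p''_1,p''_2,p''_3)$ are triangles (pairwise collinear, non-collinear triples) and for each $\{i,j,k\}=\{1,2,3\}$ the lines $p'_ip'_j$ and $p''_ip''_j$ meet in a point $q_k$, then $q_1,q_2,q_3$ are collinear. -}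

module Defs where

open import Data.Nat using (ℕ; suc)
open import Data.Fin using (Fin; zero; suc)
open import Data.Vec using (Vec; []; _∷_; zipWith; replicate; updateAt)
open import Data.Product using (Σ; ∃; _×_; _,_)
open import Data.Empty using (⊥)
open import Relation.Nullary using (¬_)
open import Relation.Binary.PropositionalEquality using (_≡_; _≢_)

C₃ : Set
C₃ = Fin 3

_⊕_ : C₃ → C₃ → C₃
zero ⊕ y = y
suc zero ⊕ zero = suc zero
suc zero ⊕ suc zero = suc (suc zero)
suc zero ⊕ suc (suc zero) = zero
suc (suc zero) ⊕ zero = suc (suc zero)
suc (suc zero) ⊕ suc zero = zero
suc (suc zero) ⊕ suc (suc zero) = suc zero

one : C₃
one = suc zero

G : ℕ → Set
G n = Vec C₃ n

_+ᴳ_ : ∀ {n} → G n → G n → G n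
_+ᴳ_ = zipWith _⊕_

𝟘 : ∀ n → G n
𝟘 n = replicate n zero

unit : ∀ n → Fin n → G n
unit n i = updateAt (𝟘 n) i (λ _ → one)

-- canonical set D_n = {e₀, e₁, …, eₙ}, indexed by Fin (suc n):
-- index zero ↦ e₀ = 0, index (suc i) ↦ e_{i+1}
e : ∀ n → Fin (suc n) → G n
e n zero = 𝟘 n
e n (suc i) = unit n i

record IncidenceStructure : Set₁ where
  field
    Point : Set
    Line  : Set
    _I_   : Point → Line → Set

module _ (S : IncidenceStructure) where
  open IncidenceStructure S

  SameLine : Line → Line → Set
  SameLine L M = ∀ p → (p I L → p I M) × (p I M → p I L)

  DistinctLines : Line → Line → Set
  DistinctLines L M = ¬ SameLine L M

  Collinear₂ : Point → Point → Set
  Collinear₂ p q = ∃ λ L → p I L × q I L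

  Collinear₃ : Point → Point → Point → Set
  Collinear₃ p q r = ∃ λ L → p I L × q I L × r I L

  Triangle : (Fin 3 → Point) → Set
  Triangle t = (∀ i j → i ≢ j → Collinear₂ (t i) (t j))
             × ¬ Collinear₃ (t zero) (t (suc zero)) (t (suc (suc zero)))

  LinesMeetIn : Point → Point → Point → Point → Point → Set
  LinesMeetIn p₁ p₂ r₁ r₂ q =
    Σ Line λ M → Σ Line λ N →
      p₁ I M × p₂ I M × r₁ I N × r₂ I N × DistinctLines M N × q I M × q I N

  Desarguesian : Set
  Desarguesian =
    (o : Point) (L : Fin 3 → Line) (p′ p″ q : Fin 3 → Point) →
    (∀ i j → i ≢ j → DistinctLines (L i) (L j)) →
    (∀ i → o I L i) →
    (∀ i → p′ i ≢ o) → (∀ i → p″ i ≢ o) →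
    (∀ i → p′ i I L i) → (∀ i → p″ i I L i) →
    Triangle p′ → Triangle p″ →
    (∀ i j k → i ≢ j → j ≢ k → i ≢ k →
       LinesMeetIn (p′ i) (p′ j) (p″ i) (p″ j) (q k)) →
    Collinear₃ (q zero) (q (suc zero)) (q (suc (suc zero)))

-- D(G, D): points are elements of G, lines are translates b + D
-- (a line is named by a base point b; equality of lines is SameLine),
-- incidence is membership.

𝐃 : ∀ n → IncidenceStructure
𝐃 n = record
  { Point = G n
  ; Line  = G n
  ; _I_   = λ p b → ∃ λ (i : Fin (suc n)) → p ≡ b +ᴳ e n i
  }

module Submission where

-- For every index a there is a homomorphism χ a : (C₃)ⁿ → C₃ with
-- χ a (e i) = δ a i + κ a (a coordinate, or minus the coordinate sum for
-- a = 0).  Hence two sums of equally many elements of Dₙ that agree have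
-- the same number of occurrences of every index, counted modulo 3.  For
-- sums of two or three terms this forces the summands to agree, except
-- for the degenerate identity 3·e_u = 3·e_p.
--
-- Let o = Lₖ + e(aₖ); the aₖ are distinct.  A triangle with
-- vertex tₖ ≠ o on Lₖ satisfies tₖ = Lₖ + e(B) for a single index B: two
-- vertices on a common line have equal or "swapped" indices, and swaps
-- are impossible for three pencil lines.  So p′ₖ = Lₖ + e B and
-- p″ₖ = Lₖ + e C, and the line p′ᵢp′ⱼ meets p″ᵢp″ⱼ in qₖ with
-- qₖ + e(aᵢ) + e(aⱼ) = o + e B + e C.  Thus every qₖ lies on the line
-- based at o + e B + e C − (e a₀ + e a₁ + e a₂).

open import Defs
open import Level using (0ℓ)
open import Data.Bool using (Bool; true; false)
open import Data.Nat using (ℕ; suc)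
open import Data.Fin using (Fin; zero; suc; _≟_)
open import Data.Fin.Properties using (all?)
open import Data.List using (List; []; _∷_; length)
open import Data.List.Membership.Propositional using (_∈_; _∉_)
open import Data.List.Relation.Unary.Any using (here; there; any?)
open import Data.List.Relation.Unary.Any.Properties using (singleton⁻)
open import Data.Vec using ([]; _∷_; map; lookup)
open import Data.Vec.Properties using (lookup-zipWith; lookup-replicate)
open import Data.Vec.Relation.Binary.Pointwise.Inductive
  using (Pointwise-≡⇒≡; zipWith-assoc; zipWith-comm; zipWith-identityʳ)
open import Data.Product using (∃; _×_; _,_; proj₁; proj₂)
open import Data.Sum using (_⊎_; inj₁; inj₂)
open import Data.Empty using (⊥; ⊥-elim)
open import Function using (_∘_)
open import Algebra.Bundles using (AbelianGroup)
open import Algebra.Core using (Op₁; Op₂)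
open import Relation.Nullary using (Dec; yes; no; does)
open import Relation.Nullary.Decidable using (toWitness; dec-true)
open import Relation.Binary.PropositionalEquality
import Algebra.Definitions as Definitions
import Algebra.Properties.AbelianGroup as AbelianGroupProperties
import Algebra.Properties.CommutativeSemigroup as CommutativeSemigroupProperties
import Algebra.Definitions.RawMonoid as RawMonoidDefinitions
import Algebra.Solver.CommutativeMonoid as CommutativeMonoidSolver

-- An abelian group whose equality is propositional equality; the left
-- identity and inverse laws follow from the right ones by commutativity.
≡-abelianGroup : {A : Set} (_∙_ : Op₂ A) (ε : A) (_⁻¹ : Op₁ A) →
                 Definitions.Associative _≡_ _∙_ → Definitions.Commutative _≡_ _∙_ →
                 Definitions.RightIdentity _≡_ ε _∙_ →
                 Definitions.RightInverse _≡_ ε _⁻¹ _∙_ →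
                 AbelianGroup 0ℓ 0ℓ
≡-abelianGroup {A} _∙_ ε _⁻¹ assoc comm identityʳ inverseʳ = record
  { Carrier = A ; _≈_ = _≡_ ; _∙_ = _∙_ ; ε = ε ; _⁻¹ = _⁻¹
  ; isAbelianGroup = record
    { isGroup = record
      { isMonoid = record
        { isSemigroup = record
          { isMagma = record { isEquivalence = isEquivalence ; ∙-cong = cong₂ _∙_ }
          ; assoc = assoc }
        ; identity = (λ x → trans (comm ε x) (identityʳ x)) , identityʳ }
      ; inverse = (λ x → trans (comm (x ⁻¹) x) (inverseʳ x)) , inverseʳ
      ; ⁻¹-cong = cong _⁻¹ }
    ; comm = comm } }

neg : C₃ → C₃
neg zero = zero
neg (suc zero) = suc (suc zero)
neg (suc (suc zero)) = suc zero

⊕-assoc : ∀ x y z → (x ⊕ y) ⊕ z ≡ x ⊕ (y ⊕ z)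
⊕-assoc = toWitness {a? = all? λ x → all? λ y → all? λ z → (x ⊕ y) ⊕ z ≟ x ⊕ (y ⊕ z)} _

⊕-comm : ∀ x y → x ⊕ y ≡ y ⊕ x
⊕-comm = toWitness {a? = all? λ x → all? λ y → x ⊕ y ≟ y ⊕ x} _

⊕-identityʳ : ∀ x → x ⊕ zero ≡ x
⊕-identityʳ = toWitness {a? = all? λ x → x ⊕ zero ≟ x} _

⊕-inverseʳ : ∀ x → x ⊕ neg x ≡ zero
⊕-inverseʳ = toWitness {a? = all? λ x → x ⊕ neg x ≟ zero} _

C₃-group : AbelianGroup 0ℓ 0ℓ
C₃-group = ≡-abelianGroup _⊕_ zero neg ⊕-assoc ⊕-comm ⊕-identityʳ ⊕-inverseʳ

module C₃ = AbelianGroupProperties C₃-group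
module C₃ᶜ = CommutativeSemigroupProperties (AbelianGroup.commutativeSemigroup C₃-group)
open RawMonoidDefinitions (AbelianGroup.rawMonoid C₃-group) using () renaming (_×_ to _·_)

negᴳ : ∀ {n} → G n → G n
negᴳ = map neg

+ᴳ-inverseʳ : ∀ {n} (x : G n) → x +ᴳ negᴳ x ≡ 𝟘 n
+ᴳ-inverseʳ [] = refl
+ᴳ-inverseʳ (a ∷ x) = cong₂ _∷_ (⊕-inverseʳ a) (+ᴳ-inverseʳ x)

+ᴳ-assoc : ∀ {n} (x y z : G n) → (x +ᴳ y) +ᴳ z ≡ x +ᴳ (y +ᴳ z)
+ᴳ-assoc x y z = Pointwise-≡⇒≡ (zipWith-assoc ⊕-assoc x y z)

+ᴳ-comm : ∀ {n} (x y : G n) → x +ᴳ y ≡ y +ᴳ x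
+ᴳ-comm x y = Pointwise-≡⇒≡ (zipWith-comm ⊕-comm x y)

+ᴳ-identityʳ : ∀ {n} (x : G n) → x +ᴳ 𝟘 n ≡ x
+ᴳ-identityʳ x = Pointwise-≡⇒≡ (zipWith-identityʳ ⊕-identityʳ x)

𝔾 : ℕ → AbelianGroup 0ℓ 0ℓ
𝔾 n = ≡-abelianGroup _+ᴳ_ (𝟘 n) negᴳ +ᴳ-assoc +ᴳ-comm +ᴳ-identityʳ +ᴳ-inverseʳ

module 𝔾 (n : ℕ) = AbelianGroupProperties (𝔾 n)
module 𝔾ᶜ (n : ℕ) = CommutativeSemigroupProperties (AbelianGroup.commutativeSemigroup (𝔾 n))

⟦_⟧ : Bool → C₃
⟦ true ⟧ = one
⟦ false ⟧ = zero

δ : ∀ {k} → Fin k → Fin k → C₃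
δ a b = ⟦ does (a ≟ b) ⟧

total : ∀ {n} → G n → C₃
total [] = zero
total (x ∷ v) = x ⊕ total v

total-homo : ∀ {n} (x y : G n) → total (x +ᴳ y) ≡ total x ⊕ total y
total-homo [] [] = refl
total-homo (a ∷ x) (b ∷ y) =
  trans (cong ((a ⊕ b) ⊕_) (total-homo x y)) (C₃ᶜ.interchange a b (total x) (total y))

total-𝟘 : ∀ n → total (𝟘 n) ≡ zero
total-𝟘 ℕ.zero = refl
total-𝟘 (suc n) = total-𝟘 n

total-unit : ∀ {n} (j : Fin n) → total (unit n j) ≡ one
total-unit {suc n} zero = cong (one ⊕_) (total-𝟘 n)
total-unit {suc n} (suc j) = total-unit j

lookup-unit : ∀ {n} (k j : Fin n) → lookup (unit n j) k ≡ δ k j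
lookup-unit zero zero = refl
lookup-unit zero (suc j) = refl
lookup-unit (suc k) zero = lookup-replicate k zero
lookup-unit (suc k) (suc j) = lookup-unit k j

χ : ∀ {n} → Fin (suc n) → G n → C₃
χ zero v = neg (total v)
χ (suc k) v = lookup v k

κ : ∀ {n} → Fin (suc n) → C₃
κ zero = neg one
κ (suc _) = zero

χ-homo : ∀ {n} (a : Fin (suc n)) (x y : G n) → χ a (x +ᴳ y) ≡ χ a x ⊕ χ a y
χ-homo zero x y = trans (cong neg (total-homo x y)) (sym (C₃.⁻¹-∙-comm (total x) (total y)))
χ-homo (suc k) x y = lookup-zipWith _⊕_ k x y

χ-𝟘 : ∀ {n} (a : Fin (suc n)) → χ a (𝟘 n) ≡ zero
χ-𝟘 {n} zero = cong neg (total-𝟘 n)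
χ-𝟘 (suc k) = lookup-replicate k zero

χ-e : ∀ {n} (a i : Fin (suc n)) → χ a (e n i) ≡ δ a i ⊕ κ a
χ-e {n} zero zero = cong neg (total-𝟘 n)
χ-e zero (suc j) = cong neg (total-unit j)
χ-e (suc k) zero = lookup-replicate k zero
χ-e (suc k) (suc j) = trans (lookup-unit k j) (sym (⊕-identityʳ (δ k j)))

Σe : ∀ {n} → List (Fin (suc n)) → G n
Σe [] = 𝟘 _
Σe (u ∷ us) = e _ u +ᴳ Σe us

count : ∀ {n} → Fin (suc n) → List (Fin (suc n)) → C₃
count a [] = zero
count a (u ∷ us) = δ a u ⊕ count a us

χ-Σe : ∀ {n} (a : Fin (suc n)) (us : List (Fin (suc n))) →
       χ a (Σe us) ≡ count a us ⊕ (length us · κ a)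
χ-Σe a [] = χ-𝟘 a
χ-Σe a (u ∷ us) = begin
  χ a (e _ u +ᴳ Σe us)                               ≡⟨ χ-homo a (e _ u) (Σe us) ⟩
  χ a (e _ u) ⊕ χ a (Σe us)                          ≡⟨ cong₂ _⊕_ (χ-e a u) (χ-Σe a us) ⟩
  (δ a u ⊕ κ a) ⊕ (count a us ⊕ (length us · κ a))   ≡⟨ C₃ᶜ.interchange (δ a u) (κ a) (count a us) _ ⟩
  (δ a u ⊕ count a us) ⊕ (κ a ⊕ (length us · κ a))   ∎
  where open ≡-Reasoning

counts-agree : ∀ {n} (us vs : List (Fin (suc n))) → length us ≡ length vs → Σe us ≡ Σe vs →
               ∀ a → count a us ≡ count a vs
counts-agree us vs same-length same-sum a = C₃.∙-cancelʳ (length us · κ a) _ _ (begin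
  count a us ⊕ (length us · κ a)   ≡⟨ sym (χ-Σe a us) ⟩
  χ a (Σe us)                      ≡⟨ cong (χ a) same-sum ⟩
  χ a (Σe vs)                      ≡⟨ χ-Σe a vs ⟩
  count a vs ⊕ (length vs · κ a)   ≡⟨ cong (λ k → count a vs ⊕ (k · κ a)) (sym same-length) ⟩
  count a vs ⊕ (length us · κ a)   ∎)
  where open ≡-Reasoning

count-head : ∀ {n} (a : Fin (suc n)) us → count a (a ∷ us) ≡ one ⊕ count a us
count-head a us = cong (λ b → ⟦ b ⟧ ⊕ count a us) (dec-true (a ≟ a) refl)

count≢0⇒∈ : ∀ {n} (a : Fin (suc n)) us → count a us ≢ zero → a ∈ us
count≢0⇒∈ a [] count≢0 = ⊥-elim (count≢0 refl)
count≢0⇒∈ a (u ∷ us) count≢0 with a ≟ u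
... | yes a≡u = here a≡u
... | no _ = there (count≢0⇒∈ a us count≢0)

∉⇒count≡0 : ∀ {n} (a : Fin (suc n)) us → a ∉ us → count a us ≡ zero
∉⇒count≡0 a [] _ = refl
∉⇒count≡0 a (u ∷ us) a∉ with a ≟ u
... | yes a≡u = ⊥-elim (a∉ (here a≡u))
... | no _ = ∉⇒count≡0 a us (a∉ ∘ there)

one-plus-indicator≢0 : ∀ {A : Set} (d : Dec A) → one ⊕ (⟦ does d ⟧ ⊕ zero) ≢ zero
one-plus-indicator≢0 (yes _) ()
one-plus-indicator≢0 (no _) ()

one-plus-indicators≡0 : ∀ {A B : Set} (d : Dec A) (d′ : Dec B) →
                        one ⊕ (⟦ does d ⟧ ⊕ (⟦ does d′ ⟧ ⊕ zero)) ≡ zero → A × B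
one-plus-indicators≡0 (yes a) (yes b) _ = a , b
one-plus-indicators≡0 (yes _) (no _) ()
one-plus-indicators≡0 (no _) (yes _) ()
one-plus-indicators≡0 (no _) (no _) ()

module _ {n : ℕ} where
  private
    E : Fin (suc n) → G n
    E = e n
    module Gₙ = 𝔾 n
    module Gₙᶜ = 𝔾ᶜ n

  Σe-pair : ∀ u v → Σe (u ∷ v ∷ []) ≡ E u +ᴳ E v
  Σe-pair u v = cong (E u +ᴳ_) (+ᴳ-identityʳ (E v))

  Σe-triple : ∀ u v w → Σe (u ∷ v ∷ w ∷ []) ≡ E u +ᴳ (E v +ᴳ E w)
  Σe-triple u v w = cong (E u +ᴳ_) (Σe-pair v w)

  e-injective : ∀ {u v} → E u ≡ E v → u ≡ v
  e-injective {u} {v} eq = singleton⁻ (count≢0⇒∈ u (v ∷ []) (subst (_≢ zero) counted λ ()))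
    where
    counted : one ≡ count u (v ∷ [])
    counted = trans (sym (count-head u [])) (counts-agree (u ∷ []) (v ∷ []) refl (cong (_+ᴳ 𝟘 n) eq) u)

  first-of-two-occurs : ∀ {u v p q} → E u +ᴳ E v ≡ E p +ᴳ E q → u ∈ (p ∷ q ∷ [])
  first-of-two-occurs {u} {v} {p} {q} eq =
    count≢0⇒∈ u (p ∷ q ∷ []) (subst (_≢ zero) counted (one-plus-indicator≢0 (u ≟ v)))
    where
    counted : one ⊕ count u (v ∷ []) ≡ count u (p ∷ q ∷ [])
    counted = trans (sym (count-head u (v ∷ [])))
      (counts-agree (u ∷ v ∷ []) (p ∷ q ∷ []) refl (trans (Σe-pair u v) (trans eq (sym (Σe-pair p q)))) u)

  two-sums : ∀ {u v p q} → E u +ᴳ E v ≡ E p +ᴳ E q → (u ≡ p × v ≡ q) ⊎ (u ≡ q × v ≡ p)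
  two-sums {u} {v} {p} {q} eq with first-of-two-occurs {u} {v} {p} {q} eq
  ... | here refl = inj₁ (refl , e-injective (Gₙ.∙-cancelˡ (E u) _ _ eq))
  ... | there (here refl) = inj₂ (refl , e-injective (Gₙ.∙-cancelˡ (E u) _ _ (trans eq (+ᴳ-comm (E p) (E u)))))

  absent⇒constant : ∀ {u v w p q r} → E u +ᴳ (E v +ᴳ E w) ≡ E p +ᴳ (E q +ᴳ E r) →
                    u ∉ (p ∷ q ∷ r ∷ []) → u ≡ v × u ≡ w
  absent⇒constant {u} {v} {w} {p} {q} {r} eq u∉ = one-plus-indicators≡0 (u ≟ v) (u ≟ w) (begin
    one ⊕ count u (v ∷ w ∷ [])   ≡⟨ sym (count-head u (v ∷ w ∷ [])) ⟩
    count u (u ∷ v ∷ w ∷ [])     ≡⟨ counts-agree (u ∷ v ∷ w ∷ []) (p ∷ q ∷ r ∷ []) refl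
                                      (trans (Σe-triple u v w) (trans eq (sym (Σe-triple p q r)))) u ⟩
    count u (p ∷ q ∷ r ∷ [])     ≡⟨ ∉⇒count≡0 u (p ∷ q ∷ r ∷ []) u∉ ⟩
    zero                         ∎)
    where open ≡-Reasoning

  three-sums : ∀ {u v w p q r} → E u +ᴳ (E v +ᴳ E w) ≡ E p +ᴳ (E q +ᴳ E r) →
               u ∈ (p ∷ q ∷ r ∷ []) ⊎ ((u ≡ v × u ≡ w) × (p ≡ q × p ≡ r))
  three-sums {u} {v} {w} {p} {q} {r} eq with any? (u ≟_) (p ∷ q ∷ r ∷ [])
  ... | yes u∈ = inj₁ u∈
  ... | no u∉ with absent⇒constant {u} {v} {w} {p} {q} {r} eq u∉
  ...   | refl , refl = inj₂ ((refl , refl) , absent⇒constant (sym eq) p∉)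
    where
    p∉ : p ∉ (u ∷ u ∷ u ∷ [])
    p∉ (here p≡u) = u∉ (here (sym p≡u))
    p∉ (there (here p≡u)) = u∉ (here (sym p≡u))
    p∉ (there (there (here p≡u))) = u∉ (here (sym p≡u))

  -- If a line M passes through Lᵢ + e b and Lⱼ + e b, the collinearity
  -- equation forces Lᵢ + e b = M + e aⱼ.
  pinned-index : ∀ {aᵢ aⱼ b x y} → E b +ᴳ (E aⱼ +ᴳ E y) ≡ E x +ᴳ (E aᵢ +ᴳ E b) → aᵢ ≢ aⱼ → x ≡ aⱼ
  pinned-index {aᵢ} {aⱼ} {b} {x} {y} eq aᵢ≢aⱼ
    with two-sums {aⱼ} {y} {x} {aᵢ} (Gₙ.∙-cancelˡ (E b) _ _ (trans eq (Gₙᶜ.x∙yz≈z∙xy (E x) (E aᵢ) (E b))))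
  ... | inj₁ (aⱼ≡x , _) = sym aⱼ≡x
  ... | inj₂ (aⱼ≡aᵢ , _) = ⊥-elim (aᵢ≢aⱼ (sym aⱼ≡aᵢ))

-- the indices bᵢ, bⱼ of two points relative to pencil indices aᵢ, aⱼ
SameOrSwapped : {A : Set} → A → A → A → A → Set
SameOrSwapped aᵢ aⱼ bᵢ bⱼ = bᵢ ≡ bⱼ ⊎ (bᵢ ≡ aⱼ × bⱼ ≡ aᵢ)

equal-of-three : ∀ {A : Set} {aᵢ aⱼ aₖ bᵢ bⱼ bₖ : A} → aᵢ ≢ aⱼ → aⱼ ≢ aₖ → aᵢ ≢ aₖ →
                 SameOrSwapped aᵢ aⱼ bᵢ bⱼ → SameOrSwapped aᵢ aₖ bᵢ bₖ →
                 SameOrSwapped aⱼ aₖ bⱼ bₖ → bᵢ ≡ bⱼ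
equal-of-three _ _ _ (inj₁ bᵢ≡bⱼ) _ _ = bᵢ≡bⱼ
equal-of-three aᵢ≢aⱼ _ _ (inj₂ (bᵢ≡aⱼ , bⱼ≡aᵢ)) (inj₁ bᵢ≡bₖ) (inj₁ bⱼ≡bₖ) =
  ⊥-elim (aᵢ≢aⱼ (trans (sym bⱼ≡aᵢ) (trans bⱼ≡bₖ (trans (sym bᵢ≡bₖ) bᵢ≡aⱼ))))
equal-of-three _ _ aᵢ≢aₖ (inj₂ (_ , bⱼ≡aᵢ)) (inj₁ _) (inj₂ (bⱼ≡aₖ , _)) =
  ⊥-elim (aᵢ≢aₖ (trans (sym bⱼ≡aᵢ) bⱼ≡aₖ))
equal-of-three _ aⱼ≢aₖ _ (inj₂ (bᵢ≡aⱼ , _)) (inj₂ (bᵢ≡aₖ , _)) _ =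
  ⊥-elim (aⱼ≢aₖ (trans (sym bᵢ≡aⱼ) bᵢ≡aₖ))

module _ {n : ℕ} where
  private
    E : Fin (suc n) → G n
    E = e n
    module Gₙ = 𝔾 n

  -- Two collinear points Lᵢ + e bᵢ ≠ o and Lⱼ + e bⱼ ≠ o on different
  -- pencil lines have equal or swapped indices (the hypothesis is their
  -- collinearity equation, see collinear-offsets below).
  swap-index : ∀ {aᵢ aⱼ bᵢ bⱼ x y} → E bᵢ +ᴳ (E aⱼ +ᴳ E y) ≡ E x +ᴳ (E aᵢ +ᴳ E bⱼ) →
               aᵢ ≢ aⱼ → bᵢ ≢ aᵢ → bⱼ ≢ aⱼ → SameOrSwapped aᵢ aⱼ bᵢ bⱼ
  swap-index {aᵢ} {aⱼ} {bᵢ} {bⱼ} {x} {y} eq aᵢ≢aⱼ bᵢ≢aᵢ bⱼ≢aⱼ with three-sums {n} {bᵢ} {aⱼ} {y} {x} {aᵢ} {bⱼ} eq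
  ... | inj₁ (here refl) = ⊥-elim (remainder-impossible (two-sums {n} {aⱼ} {y} {aᵢ} {bⱼ} (Gₙ.∙-cancelˡ (E x) _ _ eq)))
    where
    remainder-impossible : (aⱼ ≡ aᵢ × y ≡ bⱼ) ⊎ (aⱼ ≡ bⱼ × y ≡ aᵢ) → ⊥
    remainder-impossible (inj₁ (aⱼ≡aᵢ , _)) = aᵢ≢aⱼ (sym aⱼ≡aᵢ)
    remainder-impossible (inj₂ (aⱼ≡bⱼ , _)) = bⱼ≢aⱼ (sym aⱼ≡bⱼ)
  ... | inj₁ (there (here bᵢ≡aᵢ)) = ⊥-elim (bᵢ≢aᵢ bᵢ≡aᵢ)
  ... | inj₁ (there (there (here bᵢ≡bⱼ))) = inj₁ bᵢ≡bⱼ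
  ... | inj₂ ((bᵢ≡aⱼ , _) , (x≡aᵢ , x≡bⱼ)) = inj₂ (bᵢ≡aⱼ , trans (sym x≡bⱼ) x≡aᵢ)

-- Incidences as linear equations in an arbitrary abelian group: a point p
-- lies on the line based at M with offset x when p = M ∙ x, and the facts
-- below eliminate the bases from such equations.

module IncidenceAlgebra {c ℓ} (A : AbelianGroup c ℓ) where
  open AbelianGroup A renaming (refl to ≈-refl; sym to ≈-sym; trans to ≈-trans)
  open AbelianGroupProperties A using (∙-cancelˡ; ∙-cancelʳ; //-rightDividesˡ)
  open CommutativeSemigroupProperties commutativeSemigroup using (xy∙z≈xz∙y)
  open CommutativeMonoidSolver commutativeMonoid using (solve; _⊜_) renaming (_⊕_ to _⊞_)
  open import Relation.Binary.Reasoning.Setoid (AbelianGroup.setoid A)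

  collinear-offsets : ∀ {o ℓᵢ ℓⱼ M aᵢ aⱼ bᵢ bⱼ x y} →
                      o ≈ ℓᵢ ∙ aᵢ → o ≈ ℓⱼ ∙ aⱼ → ℓᵢ ∙ bᵢ ≈ M ∙ x → ℓⱼ ∙ bⱼ ≈ M ∙ y →
                      bᵢ ∙ (aⱼ ∙ y) ≈ x ∙ (aᵢ ∙ bⱼ)
  collinear-offsets {o} {ℓᵢ} {ℓⱼ} {M} {aᵢ} {aⱼ} {bᵢ} {bⱼ} {x} {y} o-onᵢ o-onⱼ onᵢ onⱼ =
    ∙-cancelˡ ℓᵢ _ _ (begin
      ℓᵢ ∙ (bᵢ ∙ (aⱼ ∙ y))   ≈⟨ ≈-sym (assoc ℓᵢ bᵢ _) ⟩
      (ℓᵢ ∙ bᵢ) ∙ (aⱼ ∙ y)   ≈⟨ ∙-congʳ onᵢ ⟩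
      (M ∙ x) ∙ (aⱼ ∙ y)     ≈⟨ solve 4 (λ M x aⱼ y → (M ⊞ x) ⊞ (aⱼ ⊞ y) ⊜ x ⊞ (aⱼ ⊞ (M ⊞ y))) ≈-refl M x aⱼ y ⟩
      x ∙ (aⱼ ∙ (M ∙ y))     ≈⟨ ∙-congˡ (∙-congˡ (≈-sym onⱼ)) ⟩
      x ∙ (aⱼ ∙ (ℓⱼ ∙ bⱼ))   ≈⟨ solve 4 (λ x aⱼ ℓⱼ bⱼ → x ⊞ (aⱼ ⊞ (ℓⱼ ⊞ bⱼ)) ⊜ x ⊞ ((ℓⱼ ⊞ aⱼ) ⊞ bⱼ)) ≈-refl x aⱼ ℓⱼ bⱼ ⟩
      x ∙ ((ℓⱼ ∙ aⱼ) ∙ bⱼ)   ≈⟨ ∙-congˡ (∙-congʳ (≈-trans (≈-sym o-onⱼ) o-onᵢ)) ⟩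
      x ∙ ((ℓᵢ ∙ aᵢ) ∙ bⱼ)   ≈⟨ solve 4 (λ x ℓᵢ aᵢ bⱼ → x ⊞ ((ℓᵢ ⊞ aᵢ) ⊞ bⱼ) ⊜ ℓᵢ ⊞ (x ⊞ (aᵢ ⊞ bⱼ))) ≈-refl x ℓᵢ aᵢ bⱼ ⟩
      ℓᵢ ∙ (x ∙ (aᵢ ∙ bⱼ))   ∎)

  meet-offsets : ∀ {ℓ M N aⱼ b c z w} →
                 M ∙ aⱼ ≈ ℓ ∙ b → N ∙ aⱼ ≈ ℓ ∙ c → M ∙ z ≈ N ∙ w → b ∙ z ≈ c ∙ w
  meet-offsets {ℓ} {M} {N} {aⱼ} {b} {c} {z} {w} M-at N-at common = ∙-cancelˡ ℓ _ _ (begin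
    ℓ ∙ (b ∙ z)    ≈⟨ ≈-sym (assoc ℓ b z) ⟩
    (ℓ ∙ b) ∙ z    ≈⟨ ∙-congʳ (≈-sym M-at) ⟩
    (M ∙ aⱼ) ∙ z   ≈⟨ xy∙z≈xz∙y M aⱼ z ⟩
    (M ∙ z) ∙ aⱼ   ≈⟨ ∙-congʳ common ⟩
    (N ∙ w) ∙ aⱼ   ≈⟨ xy∙z≈xz∙y N w aⱼ ⟩
    (N ∙ aⱼ) ∙ w   ≈⟨ ∙-congʳ N-at ⟩
    (ℓ ∙ c) ∙ w    ≈⟨ assoc ℓ c w ⟩
    ℓ ∙ (c ∙ w)    ∎)

  meet-point : ∀ {o ℓ M q aᵢ aⱼ b c} →
               q ≈ M ∙ c → M ∙ aⱼ ≈ ℓ ∙ b → o ≈ ℓ ∙ aᵢ → q ∙ (aᵢ ∙ aⱼ) ≈ (o ∙ b) ∙ c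
  meet-point {o} {ℓ} {M} {q} {aᵢ} {aⱼ} {b} {c} q-at M-at o-at = begin
    q ∙ (aᵢ ∙ aⱼ)         ≈⟨ ∙-congʳ q-at ⟩
    (M ∙ c) ∙ (aᵢ ∙ aⱼ)   ≈⟨ solve 4 (λ M c aᵢ aⱼ → (M ⊞ c) ⊞ (aᵢ ⊞ aⱼ) ⊜ ((M ⊞ aⱼ) ⊞ aᵢ) ⊞ c) ≈-refl M c aᵢ aⱼ ⟩
    ((M ∙ aⱼ) ∙ aᵢ) ∙ c   ≈⟨ ∙-congʳ (∙-congʳ M-at) ⟩
    ((ℓ ∙ b) ∙ aᵢ) ∙ c    ≈⟨ ∙-congʳ (xy∙z≈xz∙y ℓ b aᵢ) ⟩
    ((ℓ ∙ aᵢ) ∙ b) ∙ c    ≈⟨ ∙-congʳ (∙-congʳ (≈-sym o-at)) ⟩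
    (o ∙ b) ∙ c           ∎

  solve-position : ∀ {q a X T Σ} → q ∙ X ≈ T → a ∙ X ≈ Σ → q ≈ (T - Σ) ∙ a
  solve-position {q} {a} {X} {T} {Σ} q-eq a-eq = ∙-cancelʳ X _ _ (begin
    q ∙ X                ≈⟨ q-eq ⟩
    T                    ≈⟨ ≈-sym (//-rightDividesˡ Σ T) ⟩
    (T - Σ) ∙ Σ          ≈⟨ ∙-congˡ (≈-sym a-eq) ⟩
    (T - Σ) ∙ (a ∙ X)    ≈⟨ ≈-sym (assoc (T - Σ) a X) ⟩
    ((T - Σ) ∙ a) ∙ X    ∎)

same-base⇒same-line : ∀ {n} {M N : G n} → M ≡ N → SameLine (𝐃 n) M N
same-base⇒same-line refl _ = (λ p∈ → p∈) , (λ p∈ → p∈)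

module Pencil {n : ℕ} (o : G n) (L : Fin 3 → G n)
              (L-distinct : ∀ i j → i ≢ j → DistinctLines (𝐃 n) (L i) (L j))
              (o∈L : ∀ k → IncidenceStructure._I_ (𝐃 n) o (L k)) where
  open IncidenceStructure (𝐃 n) using (_I_)
  open IncidenceAlgebra (𝔾 n)
  private
    E : Fin (suc n) → G n
    E = e n

  a : Fin 3 → Fin (suc n)
  a k = proj₁ (o∈L k)

  o-at : ∀ k → o ≡ L k +ᴳ E (a k)
  o-at k = proj₂ (o∈L k)

  a-injective : ∀ {i j} → i ≢ j → a i ≢ a j
  a-injective {i} {j} i≢j aᵢ≡aⱼ = L-distinct i j i≢j (same-base⇒same-line
    (𝔾.∙-cancelʳ n (E (a j)) _ _ (trans (sym (subst (λ u → o ≡ L i +ᴳ E u) aᵢ≡aⱼ (o-at i))) (o-at j))))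

  index≢a : ∀ {k t} → t ≢ o → (t∈L : t I L k) → proj₁ t∈L ≢ a k
  index≢a {k} t≢o (b , t-at) b≡aₖ = t≢o (trans t-at (trans (cong (λ u → L k +ᴳ E u) b≡aₖ) (sym (o-at k))))

  common-index : (t : Fin 3 → G n) → (∀ k → t k ≢ o) → (∀ k → t k I L k) → Triangle (𝐃 n) t →
                 ∃ λ B → ∀ k → t k ≡ L k +ᴳ E B
  common-index t t≢o t∈L (collinear , _) =
    r zero , λ k → trans (proj₂ (t∈L k)) (cong (λ u → L k +ᴳ E u) (r-constant k))
    where
    r : Fin 3 → Fin (suc n)
    r k = proj₁ (t∈L k)
    pair : ∀ i j → i ≢ j → SameOrSwapped (a i) (a j) (r i) (r j)
    pair i j i≢j with collinear i j i≢j
    ... | M , (x , tᵢ-on-M) , (y , tⱼ-on-M) =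
      swap-index {n} {a i} {a j} {r i} {r j} {x} {y}
        (collinear-offsets (o-at i) (o-at j)
          (trans (sym (proj₂ (t∈L i))) tᵢ-on-M) (trans (sym (proj₂ (t∈L j))) tⱼ-on-M))
        (a-injective i≢j) (index≢a (t≢o i) (t∈L i)) (index≢a (t≢o j) (t∈L j))
    r-constant : ∀ k → r k ≡ r zero
    r-constant zero = refl
    r-constant (suc zero) = sym (equal-of-three (a-injective (λ ())) (a-injective (λ ())) (a-injective (λ ()))
      (pair zero (suc zero) (λ ())) (pair zero (suc (suc zero)) (λ ())) (pair (suc zero) (suc (suc zero)) (λ ())))
    r-constant (suc (suc zero)) = sym (equal-of-three (a-injective (λ ())) (a-injective (λ ())) (a-injective (λ ()))
      (pair zero (suc (suc zero)) (λ ())) (pair zero (suc zero) (λ ())) (pair (suc (suc zero)) (suc zero) (λ ())))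

  through-common-index : ∀ {i j} B M → i ≢ j → (L i +ᴳ E B) I M → (L j +ᴳ E B) I M →
                         M +ᴳ E (a j) ≡ L i +ᴳ E B
  through-common-index {i} {j} B M i≢j (x , onᵢ) (y , onⱼ) =
    trans (cong (λ u → M +ᴳ E u) (sym x≡aⱼ)) (sym onᵢ)
    where
    x≡aⱼ : x ≡ a j
    x≡aⱼ = pinned-index {n} {a i} {a j} {B} {x} {y} (collinear-offsets (o-at i) (o-at j) onᵢ onⱼ) (a-injective i≢j)

  meet-index : ∀ {ℓ M N aⱼ} B C {z w} → DistinctLines (𝐃 n) M N →
               M +ᴳ E aⱼ ≡ ℓ +ᴳ E B → N +ᴳ E aⱼ ≡ ℓ +ᴳ E C → M +ᴳ E z ≡ N +ᴳ E w → z ≡ C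
  meet-index {ℓ} {M} {N} {aⱼ} B C {z} {w} M≠N M-at N-at common
    with two-sums {n} {B} {z} {C} {w} (meet-offsets M-at N-at common)
  ... | inj₁ (refl , _) = ⊥-elim (M≠N (same-base⇒same-line (𝔾.∙-cancelʳ n (E aⱼ) _ _ (trans M-at (sym N-at)))))
  ... | inj₂ (_ , z≡C) = z≡C

  meet-position : ∀ {i j} B C {p′ᵢ p′ⱼ p″ᵢ p″ⱼ x} → i ≢ j →
                  p′ᵢ ≡ L i +ᴳ E B → p′ⱼ ≡ L j +ᴳ E B → p″ᵢ ≡ L i +ᴳ E C → p″ⱼ ≡ L j +ᴳ E C →
                  LinesMeetIn (𝐃 n) p′ᵢ p′ⱼ p″ᵢ p″ⱼ x → x +ᴳ (E (a i) +ᴳ E (a j)) ≡ (o +ᴳ E B) +ᴳ E C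
  meet-position {i} {j} B C i≢j p′ᵢ-at p′ⱼ-at p″ᵢ-at p″ⱼ-at
    (M , N , p′ᵢ∈M , p′ⱼ∈M , p″ᵢ∈N , p″ⱼ∈N , M≠N , (z , x-on-M) , (w , x-on-N)) =
    meet-point (trans x-on-M (cong (λ u → M +ᴳ E u) z≡C)) M-at (o-at i)
    where
    M-at : M +ᴳ E (a j) ≡ L i +ᴳ E B
    M-at = through-common-index B M i≢j (subst (_I M) p′ᵢ-at p′ᵢ∈M) (subst (_I M) p′ⱼ-at p′ⱼ∈M)
    N-at : N +ᴳ E (a j) ≡ L i +ᴳ E C
    N-at = through-common-index C N i≢j (subst (_I N) p″ᵢ-at p″ᵢ∈N) (subst (_I N) p″ⱼ-at p″ⱼ∈N)
    z≡C : z ≡ C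
    z≡C = meet-index {aⱼ = a j} B C {z} {w} M≠N M-at N-at (trans (sym x-on-M) x-on-N)

proposition4p6 : (m : ℕ) → Desarguesian (𝐃 (suc m))
proposition4p6 m o L p′ p″ q L-distinct o∈L p′≢o p″≢o p′∈L p″∈L triangle′ triangle″ meet =
  S , q-on-S (suc zero) (suc (suc zero)) zero (λ ()) (λ ()) (λ ()) refl
    , q-on-S zero (suc (suc zero)) (suc zero) (λ ()) (λ ()) (λ ()) (𝔾ᶜ.x∙yz≈y∙xz n _ _ _)
    , q-on-S zero (suc zero) (suc (suc zero)) (λ ()) (λ ()) (λ ()) (𝔾ᶜ.x∙yz≈y∙zx n _ _ _)
  where
  n = suc m
  open Pencil o L L-distinct o∈L
  open IncidenceAlgebra (𝔾 n) using (solve-position)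
  B C : Fin (suc n)
  B = proj₁ (common-index p′ p′≢o p′∈L triangle′)
  C = proj₁ (common-index p″ p″≢o p″∈L triangle″)
  p′-at : ∀ k → p′ k ≡ L k +ᴳ e n B
  p′-at = proj₂ (common-index p′ p′≢o p′∈L triangle′)
  p″-at : ∀ k → p″ k ≡ L k +ᴳ e n C
  p″-at = proj₂ (common-index p″ p″≢o p″∈L triangle″)
  Σa S : G n
  Σa = e n (a zero) +ᴳ (e n (a (suc zero)) +ᴳ e n (a (suc (suc zero))))
  S = ((o +ᴳ e n B) +ᴳ e n C) +ᴳ negᴳ Σa
  q-on-S : ∀ i j k → i ≢ j → j ≢ k → i ≢ k →
           e n (a k) +ᴳ (e n (a i) +ᴳ e n (a j)) ≡ Σa → ∃ λ x → q k ≡ S +ᴳ e n x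
  q-on-S i j k i≢j j≢k i≢k a-sum = a k , solve-position
    (meet-position B C i≢j (p′-at i) (p′-at j) (p″-at i) (p″-at j) (meet i j k i≢j j≢k i≢k)) a-sum
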